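{- Let $r\ge3$ be an integer and for integers $n$ let $P_n=\dfrac{n\left(n(r-2)-(r-4)\right)}{2}$ (the $r$-gonal numbers). For integers $n\ge1$ and $k\ge1$, the triangle with vertices $(P_n,P_{n+k})$, $(P_{n+2k},P_{n+3k})$, $(P_{n+4k},P_{n+5k})$ has area $4(r-2)^2k^4$.
   Context: The area of the triangle with vertices $(x_1,y_1),(x_2,y_2),(x_3,y_3)$ is $\frac12\left|(x_2-x_1)(y_3-y_1)-(x_3-x_1)(y_2-y_1)\right|$. -}

module Defs where

open import Data.Integer as ℤ using (ℤ; +_)
open import Data.Rational using (ℚ; _+_; _-_; _*_; ∣_∣; ½; _/_)

P : ℤ → ℤ → ℚ
P r n = (n ℤ.* (n ℤ.* (r ℤ.- + 2) ℤ.- (r ℤ.- + 4))) / 2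

area : ℚ → ℚ → ℚ → ℚ → ℚ → ℚ → ℚ
area x₁ y₁ x₂ y₂ x₃ y₃ =
  ½ * ∣ (x₂ - x₁) * (y₃ - y₁) - (x₃ - x₁) * (y₂ - y₁) ∣

-- Doubling P_n gives an integer quadratic in n with leading coefficient r - 2, and the
-- determinant in the area formula is homogeneous of degree 2, so the whole computation moves
-- to ℤ. There, for any quadratic f(m) = a m² + b m + c sampled along n, n + k, …, n + 5k,
-- the determinant is -32 a² k⁴, independent of b, c and n.

module Submission where

open import Defs
open import Data.Nat using (z≤n; s≤s)
open import Data.Integer as ℤ using (ℤ; +_; _≤_; +≤+; _+_; _*_; _-_; _^_)
open import Data.Integer.Properties using (*-identityʳ)
open import Data.Integer.Solver renaming (module +-*-Solver to ℤ-Solver)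
open import Data.Rational as ℚ using (ℚ; _/_; ½; ∣_∣; 0ℚ; fromℚᵘ; toℚᵘ)
open import Data.Rational.Properties
  using ( fromℚᵘ-cong; fromℚᵘ-toℚᵘ; toℚᵘ-fromℚᵘ; toℚᵘ-homo-+; toℚᵘ-homo-*; toℚᵘ-homo‿-
        ; normalize-nonNeg; nonNegative⁻¹; 0≤p⇒∣p∣≡p; ∣p*q∣≡∣p∣*∣q∣; *-assoc)
open import Data.Rational.Solver using (module +-*-Solver)
import Data.Rational.Unnormalised as ℚᵘ
import Data.Rational.Unnormalised.Properties as ℚᵘ
open import Relation.Binary.PropositionalEquality using (_≡_; _≗_; refl; sym; trans; cong; cong₂; module ≡-Reasoning)
open ≡-Reasoning

fromℚᵘ-homo-+ : ∀ p q → fromℚᵘ (p ℚᵘ.+ q) ≡ fromℚᵘ p ℚ.+ fromℚᵘ q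
fromℚᵘ-homo-+ p q = begin
  fromℚᵘ (p ℚᵘ.+ q)
    ≡⟨ fromℚᵘ-cong (ℚᵘ.+-cong (ℚᵘ.≃-sym (toℚᵘ-fromℚᵘ p)) (ℚᵘ.≃-sym (toℚᵘ-fromℚᵘ q))) ⟩
  fromℚᵘ (toℚᵘ (fromℚᵘ p) ℚᵘ.+ toℚᵘ (fromℚᵘ q))
    ≡⟨ fromℚᵘ-cong (ℚᵘ.≃-sym (toℚᵘ-homo-+ (fromℚᵘ p) (fromℚᵘ q))) ⟩
  fromℚᵘ (toℚᵘ (fromℚᵘ p ℚ.+ fromℚᵘ q))
    ≡⟨ fromℚᵘ-toℚᵘ _ ⟩
  fromℚᵘ p ℚ.+ fromℚᵘ q ∎

fromℚᵘ-homo-* : ∀ p q → fromℚᵘ (p ℚᵘ.* q) ≡ fromℚᵘ p ℚ.* fromℚᵘ q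
fromℚᵘ-homo-* p q = begin
  fromℚᵘ (p ℚᵘ.* q)
    ≡⟨ fromℚᵘ-cong (ℚᵘ.*-cong (ℚᵘ.≃-sym (toℚᵘ-fromℚᵘ p)) (ℚᵘ.≃-sym (toℚᵘ-fromℚᵘ q))) ⟩
  fromℚᵘ (toℚᵘ (fromℚᵘ p) ℚᵘ.* toℚᵘ (fromℚᵘ q))
    ≡⟨ fromℚᵘ-cong (ℚᵘ.≃-sym (toℚᵘ-homo-* (fromℚᵘ p) (fromℚᵘ q))) ⟩
  fromℚᵘ (toℚᵘ (fromℚᵘ p ℚ.* fromℚᵘ q))
    ≡⟨ fromℚᵘ-toℚᵘ _ ⟩
  fromℚᵘ p ℚ.* fromℚᵘ q ∎

fromℚᵘ-homo‿- : ∀ p → fromℚᵘ (ℚᵘ.- p) ≡ ℚ.- fromℚᵘ p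
fromℚᵘ-homo‿- p = begin
  fromℚᵘ (ℚᵘ.- p)                 ≡⟨ fromℚᵘ-cong (ℚᵘ.-‿cong (ℚᵘ.≃-sym (toℚᵘ-fromℚᵘ p))) ⟩
  fromℚᵘ (ℚᵘ.- toℚᵘ (fromℚᵘ p))   ≡⟨ fromℚᵘ-cong (ℚᵘ.≃-sym (toℚᵘ-homo‿- (fromℚᵘ p))) ⟩
  fromℚᵘ (toℚᵘ (ℚ.- fromℚᵘ p))    ≡⟨ fromℚᵘ-toℚᵘ _ ⟩
  ℚ.- fromℚᵘ p                    ∎

fromℚᵘ-homo-- : ∀ p q → fromℚᵘ (p ℚᵘ.- q) ≡ fromℚᵘ p ℚ.- fromℚᵘ q
fromℚᵘ-homo-- p q = trans (fromℚᵘ-homo-+ p (ℚᵘ.- q)) (cong (fromℚᵘ p ℚ.+_) (fromℚᵘ-homo‿- q))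

/1-homo-- : ∀ i j → (i - j) ℚᵘ./ 1 ℚᵘ.≃ i ℚᵘ./ 1 ℚᵘ.- j ℚᵘ./ 1
/1-homo-- i j =
  ℚᵘ.*≡* (cong (_* + 1) (cong₂ _+_ (sym (*-identityʳ i)) (sym (*-identityʳ (ℤ.- j)))))

i/2≃i/1*½ : ∀ i → i ℚᵘ./ 2 ℚᵘ.≃ i ℚᵘ./ 1 ℚᵘ.* ℚᵘ.½
i/2≃i/1*½ i = ℚᵘ.*≡* (cong (_* + 2) (sym (*-identityʳ i)))

ι : ℤ → ℚ
ι i = i / 1

ι-homo-* : ∀ i j → ι (i * j) ≡ ι i ℚ.* ι j
ι-homo-* i j = fromℚᵘ-homo-* (i ℚᵘ./ 1) (j ℚᵘ./ 1)

ι-homo-- : ∀ i j → ι (i - j) ≡ ι i ℚ.- ι j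
ι-homo-- i j = begin
  fromℚᵘ ((i - j) ℚᵘ./ 1)               ≡⟨ fromℚᵘ-cong (/1-homo-- i j) ⟩
  fromℚᵘ (i ℚᵘ./ 1 ℚᵘ.- j ℚᵘ./ 1)      ≡⟨ fromℚᵘ-homo-- (i ℚᵘ./ 1) (j ℚᵘ./ 1) ⟩
  ι i ℚ.- ι j                           ∎

ι-nonNeg : ∀ {i} → + 0 ≤ i → 0ℚ ℚ.≤ ι i
ι-nonNeg (+≤+ {n = n} z≤n) = nonNegative⁻¹ (ι (+ n)) {{normalize-nonNeg n 1}}

i/2≡ι[i]*½ : ∀ i → i / 2 ≡ ι i ℚ.* ½
i/2≡ι[i]*½ i = begin
  fromℚᵘ (i ℚᵘ./ 2)              ≡⟨ fromℚᵘ-cong (i/2≃i/1*½ i) ⟩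
  fromℚᵘ (i ℚᵘ./ 1 ℚᵘ.* ℚᵘ.½)   ≡⟨ fromℚᵘ-homo-* (i ℚᵘ./ 1) ℚᵘ.½ ⟩
  ι i ℚ.* ½                      ∎

doubleSignedArea : ℚ → ℚ → ℚ → ℚ → ℚ → ℚ → ℚ
doubleSignedArea x₁ y₁ x₂ y₂ x₃ y₃ = (x₂ ℚ.- x₁) ℚ.* (y₃ ℚ.- y₁) ℚ.- (x₃ ℚ.- x₁) ℚ.* (y₂ ℚ.- y₁)

doubleSignedAreaℤ : ℤ → ℤ → ℤ → ℤ → ℤ → ℤ → ℤ
doubleSignedAreaℤ a₁ b₁ a₂ b₂ a₃ b₃ = (a₂ - a₁) * (b₃ - b₁) - (a₃ - a₁) * (b₂ - b₁)

ι-doubleSignedArea : ∀ a₁ b₁ a₂ b₂ a₃ b₃ →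
  ι (doubleSignedAreaℤ a₁ b₁ a₂ b₂ a₃ b₃) ≡ doubleSignedArea (ι a₁) (ι b₁) (ι a₂) (ι b₂) (ι a₃) (ι b₃)
ι-doubleSignedArea a₁ b₁ a₂ b₂ a₃ b₃ =
  trans (ι-homo-- ((a₂ - a₁) * (b₃ - b₁)) ((a₃ - a₁) * (b₂ - b₁)))
        (cong₂ ℚ._-_ (ι-homo-×- a₂ a₁ b₃ b₁) (ι-homo-×- a₃ a₁ b₂ b₁))
  where
  ι-homo-×- : ∀ a a′ b b′ → ι ((a - a′) * (b - b′)) ≡ (ι a ℚ.- ι a′) ℚ.* (ι b ℚ.- ι b′)
  ι-homo-×- a a′ b b′ = trans (ι-homo-* (a - a′) (b - b′)) (cong₂ ℚ._*_ (ι-homo-- a a′) (ι-homo-- b b′))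

doubleSignedArea-*ʳ : ∀ x₁ y₁ x₂ y₂ x₃ y₃ h →
  doubleSignedArea (x₁ ℚ.* h) (y₁ ℚ.* h) (x₂ ℚ.* h) (y₂ ℚ.* h) (x₃ ℚ.* h) (y₃ ℚ.* h)
    ≡ doubleSignedArea x₁ y₁ x₂ y₂ x₃ y₃ ℚ.* (h ℚ.* h)
doubleSignedArea-*ʳ = solve 7
  (λ x₁ y₁ x₂ y₂ x₃ y₃ h →
    ((x₂ :* h) :- (x₁ :* h)) :* ((y₃ :* h) :- (y₁ :* h)) :- ((x₃ :* h) :- (x₁ :* h)) :* ((y₂ :* h) :- (y₁ :* h))
      := ((x₂ :- x₁) :* (y₃ :- y₁) :- (x₃ :- x₁) :* (y₂ :- y₁)) :* (h :* h))
  refl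
  where open +-*-Solver

doubleSignedArea-/2 : ∀ a₁ b₁ a₂ b₂ a₃ b₃ →
  doubleSignedArea (a₁ / 2) (b₁ / 2) (a₂ / 2) (b₂ / 2) (a₃ / 2) (b₃ / 2)
    ≡ ι (doubleSignedAreaℤ a₁ b₁ a₂ b₂ a₃ b₃) ℚ.* (½ ℚ.* ½)
doubleSignedArea-/2 a₁ b₁ a₂ b₂ a₃ b₃
  rewrite i/2≡ι[i]*½ a₁ | i/2≡ι[i]*½ b₁ | i/2≡ι[i]*½ a₂
        | i/2≡ι[i]*½ b₂ | i/2≡ι[i]*½ a₃ | i/2≡ι[i]*½ b₃
        | ι-doubleSignedArea a₁ b₁ a₂ b₂ a₃ b₃
        = doubleSignedArea-*ʳ (ι a₁) (ι b₁) (ι a₂) (ι b₂) (ι a₃) (ι b₃) ½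

onProgression : {A B : Set} → (A → A → A → A → A → A → B) → (ℤ → A) → ℤ → ℤ → B
onProgression F f n k = F (f n) (f (n + k)) (f (n + + 2 * k)) (f (n + + 3 * k)) (f (n + + 4 * k)) (f (n + + 5 * k))

onProgression-≗ : ∀ {A B : Set} (F : A → A → A → A → A → A → B) {f g : ℤ → A} → f ≗ g → ∀ n k →
  onProgression F f n k ≡ onProgression F g n k
onProgression-≗ F f≗g n k
  rewrite f≗g n | f≗g (n + k) | f≗g (n + + 2 * k) | f≗g (n + + 3 * k) | f≗g (n + + 4 * k) | f≗g (n + + 5 * k)
  = refl

quadratic : ℤ → ℤ → ℤ → ℤ → ℤ
quadratic a b c m = a * m * m + b * m + c

doubleSignedAreaℤ-quadratic : ∀ a b c n k →
  onProgression doubleSignedAreaℤ (quadratic a b c) n k ≡ + 4 * a ^ 2 * k ^ 4 * ℤ.- + 8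
doubleSignedAreaℤ-quadratic = solve 5
  (λ a b c n k →
    let f : Polynomial 5 → Polynomial 5
        f m = a :* m :* m :+ b :* m :+ c
    in  dsa (f n) (f (n :+ k)) (f (n :+ con (+ 2) :* k)) (f (n :+ con (+ 3) :* k))
            (f (n :+ con (+ 4) :* k)) (f (n :+ con (+ 5) :* k))
          := con (+ 4) :* a :^ 2 :* k :^ 4 :* :- con (+ 8))
  refl
  where
  open ℤ-Solver
  dsa : ∀ {m} → Polynomial m → Polynomial m → Polynomial m → Polynomial m → Polynomial m → Polynomial m →
        Polynomial m
  dsa a₁ b₁ a₂ b₂ a₃ b₃ = (a₂ :- a₁) :* (b₃ :- b₁) :- (a₃ :- a₁) :* (b₂ :- b₁)

doubleP : ℤ → ℤ → ℤ
doubleP r n = n * (n * (r - + 2) - (r - + 4))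

doubleP-quadratic : ∀ r → doubleP r ≗ quadratic (r - + 2) (+ 4 - r) (+ 0)
doubleP-quadratic r m = solve 2
  (λ r m → m :* (m :* (r :- con (+ 2)) :- (r :- con (+ 4)))
             := (r :- con (+ 2)) :* m :* m :+ (con (+ 4) :- r) :* m :+ con (+ 0))
  refl r m
  where open ℤ-Solver

½*∣ι[t*-8]*¼∣≡ι[t] : ∀ t → + 0 ≤ t → ½ ℚ.* ∣ ι (t * ℤ.- + 8) ℚ.* (½ ℚ.* ½) ∣ ≡ ι t
½*∣ι[t*-8]*¼∣≡ι[t] t 0≤t = begin
  ½ ℚ.* ∣ ι (t * ℤ.- + 8) ℚ.* (½ ℚ.* ½) ∣
    ≡⟨ cong (λ x → ½ ℚ.* ∣ x ℚ.* (½ ℚ.* ½) ∣) (ι-homo-* t (ℤ.- + 8)) ⟩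
  ½ ℚ.* ∣ ι t ℚ.* ι (ℤ.- + 8) ℚ.* (½ ℚ.* ½) ∣
    ≡⟨ cong (λ x → ½ ℚ.* ∣ x ∣) (*-assoc (ι t) (ι (ℤ.- + 8)) (½ ℚ.* ½)) ⟩
  ½ ℚ.* ∣ ι t ℚ.* (ι (ℤ.- + 8) ℚ.* (½ ℚ.* ½)) ∣
    ≡⟨ cong (½ ℚ.*_) (∣p*q∣≡∣p∣*∣q∣ (ι t) (ι (ℤ.- + 8) ℚ.* (½ ℚ.* ½))) ⟩
  ½ ℚ.* (∣ ι t ∣ ℚ.* ι (+ 2))
    ≡⟨ solve 1 (λ x → con ½ :* (x :* con (ι (+ 2))) := x) refl ∣ ι t ∣ ⟩
  ∣ ι t ∣
    ≡⟨ 0≤p⇒∣p∣≡p (ι-nonNeg 0≤t) ⟩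
  ι t ∎
  where open +-*-Solver

-- Matching on the hypotheses makes r - 2 and k successor literals, so the product computes to
-- a non-negative constructor form.
area-value-nonNeg : ∀ r k → + 3 ≤ r → + 1 ≤ k → + 0 ≤ + 4 * (r - + 2) ^ 2 * k ^ 4
area-value-nonNeg .(+ _) .(+ _) (+≤+ (s≤s (s≤s (s≤s _)))) (+≤+ (s≤s _)) = +≤+ z≤n

theorem4p1 : (r n k : ℤ) → + 3 ≤ r → + 1 ≤ n → + 1 ≤ k →
    area (P r n) (P r (n + k))
         (P r (n + + 2 * k)) (P r (n + + 3 * k))
         (P r (n + + 4 * k)) (P r (n + + 5 * k))
      ≡ (+ 4 * (r - + 2) ^ 2 * k ^ 4) / 1
theorem4p1 r n k 3≤r _ 1≤k = begin
  ½ ℚ.* ∣ onProgression doubleSignedArea (P r) n k ∣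
    ≡⟨ cong (λ x → ½ ℚ.* ∣ x ∣) (doubleSignedArea-/2 (doubleP r n) (doubleP r (n + k))
                                  (doubleP r (n + + 2 * k)) (doubleP r (n + + 3 * k))
                                  (doubleP r (n + + 4 * k)) (doubleP r (n + + 5 * k))) ⟩
  ½ ℚ.* ∣ ι (onProgression doubleSignedAreaℤ (doubleP r) n k) ℚ.* (½ ℚ.* ½) ∣
    ≡⟨ cong (λ x → ½ ℚ.* ∣ ι x ℚ.* (½ ℚ.* ½) ∣)
            (trans (onProgression-≗ doubleSignedAreaℤ (doubleP-quadratic r) n k)
                   (doubleSignedAreaℤ-quadratic (r - + 2) (+ 4 - r) (+ 0) n k)) ⟩
  ½ ℚ.* ∣ ι (T * ℤ.- + 8) ℚ.* (½ ℚ.* ½) ∣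
    ≡⟨ ½*∣ι[t*-8]*¼∣≡ι[t] T (area-value-nonNeg r k 3≤r 1≤k) ⟩
  ι T ∎
  where T = + 4 * (r - + 2) ^ 2 * k ^ 4
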